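{- Let $G$ be a finite simple connected graph, let $\ell \ge 1$, and let $T$ be a subgraph of $G$ which is a tree and is isometric in $G$ (i.e. $d_T(x,y)=d_G(x,y)$ for all $x,y\in V(T)$). Then $c_\ell(T)\le c_\ell(G)$.
   Context: $\ell$-visibility Cops and Robber on a graph $G$: in round 0 a set of cops each choose a vertex, then a single robber chooses a vertex. In each subsequent round, every cop moves to a neighbouring vertex or stays put, and then the robber moves to a neighbouring vertex or stays put. The robber always knows the positions of all cops. The cops know the robber's position only at moments when some cop and the robber occupy vertices $x,y$ with $d(x,y)\le \ell$. The cops capture the robber if a cop occupies the robber's vertex. $c_\ell(G)$ is the minimum number of cops that can guarantee capture. -}

module Defs where

open import Data.Nat using (ℕ; zero; suc; _≤_)
open import Data.Fin using (Fin)
open import Data.Fin.Properties using () renaming (_≟_ to _≟ᶠ_)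
open import Data.Bool using (Bool; true; false; _∨_; _∧_; if_then_else_)
open import Data.List using (List; []; _∷_; _++_; allFin; length)
open import Data.Bool.ListAction using (any)
open import Data.List.Relation.Unary.Unique.Propositional using (Unique)
open import Data.List.Relation.Unary.Linked using (Linked)
open import Data.Maybe using (Maybe; just; nothing)
open import Data.Product using (Σ; ∃; _×_; _,_; proj₁; proj₂)
open import Data.Sum using (_⊎_)
open import Relation.Nullary using (¬_)
open import Relation.Nullary.Decidable using (⌊_⌋)
open import Relation.Binary.PropositionalEquality using (_≡_)
open import Function.Definitions using (Injective)

record Graph (n : ℕ) : Set where
  field
    adj    : Fin n → Fin n → Bool
    sym    : ∀ x y → adj x y ≡ adj y x
    irrefl : ∀ x → adj x x ≡ false
open Graph public

Adj : ∀ {n} → Graph n → Fin n → Fin n → Set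
Adj G x y = adj G x y ≡ true

within : ∀ {n} → Graph n → ℕ → Fin n → Fin n → Bool
within G zero    x y = ⌊ x ≟ᶠ y ⌋
within {n} G (suc k) x y =
  within G k x y ∨ any (λ z → within G k x z ∧ adj G z y) (allFin n)

-- graph distance: least k with d(x,y) ≤ k, searched for k < n
-- (correct for connected graphs, where d(x,y) ≤ n - 1)
distFrom : ∀ {n} → Graph n → Fin n → Fin n → ℕ → ℕ → ℕ
distFrom G x y k zero       = k
distFrom G x y k (suc fuel) =
  if within G k x y then k else distFrom G x y (suc k) fuel

dist : ∀ {n} → Graph n → Fin n → Fin n → ℕ
dist {n} G x y = distFrom G x y 0 n

Connected : ∀ {n} → Graph n → Set
Connected G = ∀ x y → ∃ λ k → within G k x y ≡ true

HasCycle : ∀ {n} → Graph n → Set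
HasCycle {n} G = Σ (Fin n) λ x → Σ (List (Fin n)) λ rest →
  (2 ≤ length rest) × Unique (x ∷ rest) × Linked (Adj G) (x ∷ rest ++ x ∷ [])

IsTree : ∀ {n} → Graph n → Set
IsTree G = Connected G × ¬ HasCycle G

IsSubgraph : ∀ {m n} → Graph m → Graph n → (Fin m → Fin n) → Set
IsSubgraph T G f = Injective _≡_ _≡_ f × (∀ x y → Adj T x y → Adj G (f x) (f y))

IsIsometricSubgraph : ∀ {m n} → Graph m → Graph n → (Fin m → Fin n) → Set
IsIsometricSubgraph T G f =
  IsSubgraph T G f × (∀ x y → dist T x y ≡ dist G (f x) (f y))

Config : ℕ → ℕ → Set
Config n k = Fin k → Fin n

Step : ∀ {n} → Graph n → Fin n → Fin n → Set
Step G x y = x ≡ y ⊎ Adj G x y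

-- a deterministic cop strategy: initial placement, and the next
-- configuration as a function of everything the cops have observed
-- (the list of observations so far; own positions are determined by it).
record Strategy (n k : ℕ) : Set where
  field
    start : Config n k
    move  : List (Maybe (Fin n)) → Config n k
open Strategy public

visible : ∀ {n k} → Graph n → ℕ → Config n k → Fin n → Bool
visible {k = k} G ℓ C r = any (λ i → within G ℓ (C i) r) (allFin k)

observe : ∀ {n k} → Graph n → ℕ → Config n k → Fin n → Maybe (Fin n)
observe G ℓ C r = if visible G ℓ C r then just r else nothing

-- state after round t: cop configuration C_t and the observation history,
-- which records an observation at every moment (after each cops' move
-- and after each robber's move).  R t is the robber position after round t.
play : ∀ {n k} → Graph n → ℕ → Strategy n k → (ℕ → Fin n) → ℕ →
       Config n k × List (Maybe (Fin n))
play G ℓ σ R zero    = start σ , observe G ℓ (start σ) (R 0) ∷ []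
play G ℓ σ R (suc t) =
  let h  = proj₂ (play G ℓ σ R t)
      C' = move σ h
  in C' , h ++ (observe G ℓ C' (R t) ∷ observe G ℓ C' (R (suc t)) ∷ [])

cops : ∀ {n k} → Graph n → ℕ → Strategy n k → (ℕ → Fin n) → ℕ → Config n k
cops G ℓ σ R t = proj₁ (play G ℓ σ R t)

RobberWalk : ∀ {n} → Graph n → (ℕ → Fin n) → Set
RobberWalk G R = ∀ t → Step G (R t) (R (suc t))

-- σ guarantees capture: against every robber play, cops' moves are legal
-- and at some moment a cop is on the robber's vertex (after the robber's
-- move of round t, or after the cops' move of round t+1).
Wins : ∀ {n k} → Graph n → ℕ → Strategy n k → Set
Wins {n} {k} G ℓ σ = (R : ℕ → Fin n) → RobberWalk G R →
  (∀ t (i : Fin k) → Step G (cops G ℓ σ R t i) (cops G ℓ σ R (suc t) i)) ×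
  (∃ λ t → ∃ λ (i : Fin k) →
     (cops G ℓ σ R t i ≡ R t) ⊎ (cops G ℓ σ R (suc t) i ≡ R t))

CopWin : ∀ {n} → Graph n → ℕ → ℕ → Set
CopWin {n} G ℓ k = Σ (Strategy n k) λ σ → Wins G ℓ σ

IsCopNumber : ∀ {n} → Graph n → ℕ → ℕ → Set
IsCopNumber G ℓ c = CopWin G ℓ c × (∀ k → CopWin G ℓ k → c ≤ k)

module Submission where

-- Let f embed the tree T isometrically in the connected graph G.  Each cop
-- of a winning team on G is accompanied by a "shadow" in T: a tree vertex s
-- with d_T(s,r) ≤ d_G(x,f r) for every tree vertex r, where x is the cop.
-- When the cop moves, its shadow can restore this invariant with a single
-- step (towards a violating vertex r₁); the tree structure enters through
-- the fact that for an edge s z, the root s separates the branch behind z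
-- from the rest of the tree.  Shadows then see every robber the cops see
-- (visibility ℓ is monotone in distance) and stand on the robber as soon as
-- a cop stands on its image.  So the T-cops win by replaying the G-strategy
-- against the image of the robber, reconstructing the G-cops' observations
-- from their own.

open import Defs hiding (sym)
open import Data.Nat using (ℕ; zero; suc; _+_; _∸_; _≤_; _<_; _≤′_; ≤′-reflexive; ≤′-step; z≤n; s≤s; s≤s⁻¹)
open import Data.Nat.Properties
open import Data.Fin using (Fin; toℕ) renaming (zero to fzero; suc to fsuc)
import Data.Fin.Properties as Finₚ
open import Data.Fin.Properties using () renaming (_≟_ to _≟ᶠ_)
open import Data.Bool using (Bool; true; false; _∨_; _∧_)
open import Data.Bool.Properties using (T-≡; ∨-zeroʳ) renaming (_≟_ to _≟ᵇ_)
open import Data.Bool.ListAction using (any)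
open import Data.List using (List; []; _∷_; _++_; allFin; length)
open import Data.List.Relation.Unary.All as All using (All; []; _∷_)
import Data.List.Relation.Unary.All.Properties as Allₚ
import Data.List.Relation.Unary.AllPairs.Properties as AllPairsₚ
open import Data.List.Relation.Unary.AllPairs using ([]; _∷_)
open import Data.List.Relation.Unary.Unique.Propositional using (Unique)
open import Data.List.Relation.Unary.Linked using (Linked; [-]; _∷_)
open import Data.List.Membership.Propositional using (_∈_; lose)
open import Data.List.Membership.Propositional.Properties using (∈-allFin)
open import Data.List.Relation.Unary.Any using (satisfied)
open import Data.List.Relation.Unary.Any.Properties using (any⁺; any⁻)
open import Data.Maybe using (Maybe; just; nothing)
open import Data.Product using (∃; _×_; _,_; proj₁; proj₂)
open import Data.Sum using (_⊎_; inj₁; inj₂)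
open import Data.Empty using (⊥-elim)
open import Relation.Binary.Definitions using (tri<; tri≈; tri>)
open import Function using (_∘_)
open import Function.Bundles using (Equivalence)
open import Relation.Nullary using (¬_; Dec; yes; no; contradiction)
open import Relation.Nullary.Decidable using (_×-dec_; isYes≗does; dec-true)
open import Relation.Binary.PropositionalEquality using (_≡_; _≢_; refl; sym; trans; cong; cong₂; subst; module ≡-Reasoning)

∨-true : ∀ a b → a ∨ b ≡ true → a ≡ true ⊎ b ≡ true
∨-true true  _ _ = inj₁ refl
∨-true false _ e = inj₂ e

∧-true : ∀ a b → a ∧ b ≡ true → a ≡ true × b ≡ true
∧-true true true _ = refl , refl

true≢false : true ≢ false
true≢false ()

any-witness : ∀ {A : Set} (P : A → Bool) xs → any P xs ≡ true → ∃ λ x → P x ≡ true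
any-witness P xs e with satisfied (any⁻ P xs (Equivalence.from T-≡ e))
... | x , t = x , Equivalence.to T-≡ t

any-intro : ∀ {A : Set} (P : A → Bool) {x xs} → x ∈ xs → P x ≡ true → any P xs ≡ true
any-intro P x∈xs e = Equivalence.to T-≡ (any⁺ P (lose x∈xs (Equivalence.from T-≡ e)))

module Walks {p : ℕ} (H : Graph p) where

  record Reach (k : ℕ) (x y : Fin p) : Set where
    constructor reach
    field holds : within H k x y ≡ true
  open Reach public

  adj-sym : ∀ {x y} → Adj H x y → Adj H y x
  adj-sym {x} {y} e = trans (Graph.sym H y x) e

  adj-irrefl : ∀ {x y} → Adj H x y → x ≢ y
  adj-irrefl {x} e refl = true≢false (trans (sym e) (irrefl H x))

  reach-zero : ∀ {x y} → Reach 0 x y → x ≡ y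
  reach-zero {x} {y} (reach e) with x ≟ᶠ y
  ... | yes x≡y = x≡y
  ... | no  _   = contradiction (sym e) true≢false

  reach-refl : ∀ {x} → Reach 0 x x
  reach-refl {x} = reach (trans (isYes≗does (x ≟ᶠ x)) (dec-true (x ≟ᶠ x) refl))

  reach-weaken : ∀ {k x y} → Reach k x y → Reach (suc k) x y
  reach-weaken {k} {x} {y} (reach e) =
    reach (cong (_∨ any (λ z → within H k x z ∧ adj H z y) (allFin p)) e)

  reach-snoc : ∀ {k x z y} → Reach k x z → Adj H z y → Reach (suc k) x y
  reach-snoc {k} {x} {z} {y} (reach e) a =
    reach (trans (cong (within H k x y ∨_) (any-intro step (∈-allFin z) step-z)) (∨-zeroʳ _))
    where
    step : Fin p → Bool
    step w = within H k x w ∧ adj H w y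
    step-z : step z ≡ true
    step-z rewrite e | a = refl

  reach-last : ∀ {k x y} → Reach (suc k) x y → Reach k x y ⊎ ∃ λ z → Reach k x z × Adj H z y
  reach-last {k} {x} {y} (reach e) with ∨-true _ _ e
  ... | inj₁ short = inj₁ (reach short)
  ... | inj₂ ends with any-witness (λ z → within H k x z ∧ adj H z y) (allFin p) ends
  ...   | z , w = inj₂ (z , reach (proj₁ (∧-true _ _ w)) , proj₂ (∧-true _ _ w))

  reach-mono : ∀ {k k' x y} → k ≤ k' → Reach k x y → Reach k' x y
  reach-mono k≤k' = go (≤⇒≤′ k≤k')
    where
    go : ∀ {k k' x y} → k ≤′ k' → Reach k x y → Reach k' x y
    go (≤′-reflexive refl) r = r
    go (≤′-step le)        r = reach-weaken (go le r)

  reach-trans : ∀ {j} k {x y z} → Reach j x y → Reach k y z → Reach (j + k) x z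
  reach-trans {j} zero {x} r q with reach-zero q
  ... | refl = subst (λ i → Reach i x _) (sym (+-identityʳ j)) r
  reach-trans {j} (suc k) {x} {y} {z} r q =
    subst (λ i → Reach i x z) (sym (+-suc j k)) (extend (reach-last q))
    where
    extend : Reach k y z ⊎ ∃ (λ w → Reach k y w × Adj H w z) → Reach (suc (j + k)) x z
    extend (inj₁ q')          = reach-weaken (reach-trans k r q')
    extend (inj₂ (w , q' , a)) = reach-snoc (reach-trans k r q') a

  reach-sym : ∀ k {x y} → Reach k x y → Reach k y x
  reach-sym zero q with reach-zero q
  ... | refl = reach-refl
  reach-sym (suc k) q with reach-last q
  ... | inj₁ q'          = reach-weaken (reach-sym k q')
  ... | inj₂ (z , q' , a) = reach-trans k (reach-snoc reach-refl (adj-sym a)) (reach-sym k q')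

  distFrom-least : ∀ {j} fuel {k x y} → j ≤ k → Reach k x y → distFrom H x y j fuel ≤ k
  distFrom-least zero       j≤k _ = j≤k
  distFrom-least {j} (suc fuel) {k} {x} {y} j≤k r with within H j x y in eq
  ... | true  = j≤k
  ... | false = distFrom-least fuel (≤∧≢⇒< j≤k j≢k) r
    where
    j≢k : j ≢ k
    j≢k refl = true≢false (trans (sym (holds r)) eq)

  distFrom-sound : ∀ j fuel x y → Reach (distFrom H x y j fuel) x y ⊎
                   (∀ i → j ≤ i → i < j + fuel → within H i x y ≡ false)
  distFrom-sound j zero x y = inj₂ λ i j≤i i<j+0 →
    contradiction j≤i (<⇒≱ (subst (i <_) (+-identityʳ j) i<j+0))
  distFrom-sound j (suc fuel) x y with within H j x y in eq
  ... | true  = inj₁ (reach eq)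
  ... | false with distFrom-sound (suc j) fuel x y
  ...   | inj₁ found   = inj₁ found
  ...   | inj₂ refuted = inj₂ refutes
    where
    refutes : ∀ i → j ≤ i → i < j + suc fuel → within H i x y ≡ false
    refutes i j≤i i<bound with i ≟ j
    ... | yes refl = eq
    ... | no  i≢j  = refuted i (≤∧≢⇒< j≤i (i≢j ∘′ sym)) (subst (i <_) (+-suc j fuel) i<bound)
      where
      _∘′_ : ∀ {A B C : Set} → (B → C) → (A → B) → A → C
      (g ∘′ h) a = g (h a)

  Grows : Fin p → ℕ → Set
  Grows x j = ∃ λ y → Reach (suc j) x y × within H j x y ≡ false

  grows? : ∀ x j → Dec (Grows x j)
  grows? x j with Finₚ.any? (λ y → (within H (suc j) x y ≟ᵇ true) ×-dec (within H j x y ≟ᵇ false))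
  ... | yes (y , r , n) = yes (y , reach r , n)
  ... | no ¬g           = no λ { (y , r , n) → ¬g (y , holds r , n) }

  ball-stable : ∀ {x J} → ¬ Grows x J → ∀ d {y} → Reach (d + J) x y → Reach J x y
  ball-stable ¬grow zero    r = r
  ball-stable {x} {J} ¬grow (suc d) {y} r with reach-last r
  ... | inj₁ r' = ball-stable ¬grow d r'
  ... | inj₂ (z , r' , a) with within H J x y in eq
  ...   | true  = reach eq
  ...   | false = contradiction (y , reach-snoc (ball-stable ¬grow d r') a , eq) ¬grow

  -- The balls cannot grow p times in a row: that would give p+1 distinct vertices.
  stalls : ∀ x → ∃ λ (J : Fin p) → ¬ Grows x (toℕ J)
  stalls x with Finₚ.all? (λ (J : Fin p) → grows? x (toℕ J))
  ... | no ¬all = Finₚ.¬∀⟶∃¬ p (λ J → Grows x (toℕ J)) (λ J → grows? x (toℕ J)) ¬all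
  ... | yes all = contradiction (Finₚ.pigeonhole (n<1+n p) new) distinct
    where
    new : Fin (suc p) → Fin p
    new fzero    = x
    new (fsuc j) = proj₁ (all j)
    new-reach : ∀ i → Reach (toℕ i) x (new i)
    new-reach fzero    = reach-refl
    new-reach (fsuc j) = proj₁ (proj₂ (all j))
    distinct : ¬ ∃ λ i → ∃ λ j → toℕ i < toℕ j × new i ≡ new j
    distinct (i , fzero , () , _)
    distinct (i , fsuc j , i<j , same) =
      true≢false (trans (sym (holds (subst (Reach (toℕ j) x) same (reach-mono (s≤s⁻¹ i<j) (new-reach i)))))
                        (proj₂ (proj₂ (all j))))

  short-walk : ∀ {K x y} → Reach K x y → ∃ λ i → i < p × Reach i x y
  short-walk {K} {x} {y} r with K <? p
  ... | yes K<p = K , K<p , r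
  ... | no  K≮p with stalls x
  ...   | J , ¬grow = toℕ J , Finₚ.toℕ<n J ,
            ball-stable ¬grow (K ∸ toℕ J) (subst (λ i → Reach i x y) (sym (m∸n+n≡m J≤K)) r)
    where
    J≤K : toℕ J ≤ K
    J≤K = ≤-trans (<⇒≤ (Finₚ.toℕ<n J)) (≮⇒≥ K≮p)

module Distance {p : ℕ} (H : Graph p) (conn : Connected H) where
  open Walks H

  d : Fin p → Fin p → ℕ
  d = dist H

  dist-reach : ∀ x y → Reach (d x y) x y
  dist-reach x y with distFrom-sound 0 p x y
  ... | inj₁ found   = found
  ... | inj₂ refuted with short-walk {K = proj₁ (conn x y)} (reach (proj₂ (conn x y)))
  ...   | i , i<p , r = contradiction (trans (sym (holds r)) (refuted i z≤n i<p)) true≢false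

  dist-least : ∀ {k x y} → Reach k x y → d x y ≤ k
  dist-least = distFrom-least p z≤n

  dist≤⇒reach : ∀ {k x y} → d x y ≤ k → Reach k x y
  dist≤⇒reach {x = x} {y} le = reach-mono le (dist-reach x y)

  dist-sym : ∀ x y → d x y ≡ d y x
  dist-sym x y = ≤-antisym (dist-least (reach-sym _ (dist-reach y x)))
                           (dist-least (reach-sym _ (dist-reach x y)))

  dist-tri : ∀ x y z → d x z ≤ d x y + d y z
  dist-tri x y z = dist-least (reach-trans _ (dist-reach x y) (dist-reach y z))

  dist-self : ∀ x → d x x ≡ 0
  dist-self x = n≤0⇒n≡0 (dist-least reach-refl)

  dist-zero : ∀ {x y} → d x y ≡ 0 → x ≡ y
  dist-zero {x} {y} e = reach-zero (subst (λ k → Reach k x y) e (dist-reach x y))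

  dist-step : ∀ {x y} → Step H x y → d x y ≤ 1
  dist-step {x} (inj₁ refl) = ≤-trans (≤-reflexive (dist-self x)) z≤n
  dist-step     (inj₂ a)    = dist-least (reach-snoc reach-refl a)

  dist-stepˡ : ∀ {x y} z → Step H x y → d x z ≤ suc (d y z)
  dist-stepˡ {x} {y} z st = ≤-trans (dist-tri x y z) (+-monoˡ-≤ (d y z) (dist-step st))

  dist-stepʳ : ∀ x {y z} → Step H y z → d x z ≤ suc (d x y)
  dist-stepʳ x {y} {z} st = begin
    d x z         ≤⟨ dist-tri x y z ⟩
    d x y + d y z ≤⟨ +-monoʳ-≤ (d x y) (dist-step st) ⟩
    d x y + 1     ≡⟨ +-comm (d x y) 1 ⟩
    suc (d x y)   ∎
    where open ≤-Reasoning

  dist-pred : ∀ {x y c} → d x y ≡ suc c → ∃ λ z → Adj H x z × d z y ≡ c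
  dist-pred {x} {y} {c} e
    with reach-last (subst (λ k → Reach k y x) (trans (dist-sym y x) e) (dist-reach y x))
  ... | inj₁ r = contradiction (dist-least (reach-sym c r)) (<⇒≱ (≤-reflexive (sym e)))
  ... | inj₂ (z , r , a) = z , adj-sym a , ≤-antisym upper lower
    where
    upper : d z y ≤ c
    upper = dist-least (reach-sym c r)
    lower : c ≤ d z y
    lower = s≤s⁻¹ (≤-trans (≤-reflexive (sym e)) (dist-stepˡ y (inj₂ (adj-sym a))))

linked-snoc : ∀ {A : Set} {R : A → A → Set} {x y b : A} (L : List A) →
              Linked R (x ∷ L ++ y ∷ []) → R y b → Linked R (x ∷ (L ++ y ∷ []) ++ b ∷ [])
linked-snoc []      (r ∷ [-])  rb = r ∷ rb ∷ [-]
linked-snoc (_ ∷ L) (r ∷ rest) rb = r ∷ linked-snoc L rest rb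

two≤length : ∀ {A : Set} (y : A) (L : List A) (b : A) → 2 ≤ length (y ∷ L ++ b ∷ [])
two≤length y []      b = s≤s (s≤s z≤n)
two≤length y (_ ∷ L) b = s≤s (s≤s z≤n)

-- In any connected graph, two distinct vertices
-- of equal depth are joined by a simple path through strictly shallower
-- vertices (`bridge`).  Acyclicity forbids closing such a path by an edge
-- or by a common deeper neighbour; hence edges change the depth by exactly
-- one and parents are unique, which is all we need about trees.

module Rooted {m : ℕ} (T : Graph m) (conn : Connected T) (acyclic : ¬ HasCycle T) (s : Fin m) where
  open Walks T
  open Distance T conn

  depth : Fin m → ℕ
  depth = d s

  shallower⇒≢ : ∀ {v w} → depth v < depth w → v ≢ w
  shallower⇒≢ lt refl = <-irrefl refl lt

  parent : ∀ {w c} → depth w ≡ suc c → ∃ λ u → Adj T w u × depth u ≡ c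
  parent {w} e with dist-pred (trans (dist-sym w s) e)
  ... | u , a , du = u , a , trans (dist-sym s u) du

  simple-path : ∀ {c a b} L → Unique L → All (λ v → depth v < c) L →
                depth a ≡ c → depth b ≡ c → a ≢ b → Unique (a ∷ L ++ b ∷ [])
  simple-path {c} {a} {b} L uniq shallow refl db a≢b =
    Allₚ.++⁺ (All.map (λ lt → shallower⇒≢ lt ∘ sym) shallow) (a≢b ∷ [])
    ∷ AllPairsₚ.++⁺ uniq ([] ∷ []) (All.map (λ lt → shallower⇒≢ (subst (_ <_) (sym db) lt) ∷ []) shallow)

  record Bridge (c : ℕ) (a b : Fin m) : Set where
    field
      inner    : List (Fin m)
      nonempty : 1 ≤ length inner
      simple   : Unique (a ∷ inner ++ b ∷ [])
      linked   : Linked (Adj T) (a ∷ inner ++ b ∷ [])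
      shallow  : All (λ v → depth v < c) inner

  bridge : ∀ c {a b} → a ≢ b → depth a ≡ c → depth b ≡ c → Bridge c a b
  bridge zero    a≢b da db = contradiction (trans (sym (dist-zero da)) (dist-zero db)) a≢b
  bridge (suc c) {a} {b} a≢b da db with parent da | parent db
  ... | pa , a~pa , dpa | pb , b~pb , dpb with pa ≟ᶠ pb
  ...   | yes refl = record
    { inner = pa ∷ [] ; nonempty = s≤s z≤n
    ; simple = simple-path (pa ∷ []) ([] ∷ []) (pa<c ∷ []) da db a≢b
    ; linked = a~pa ∷ adj-sym b~pb ∷ [-]
    ; shallow = pa<c ∷ [] }
    where
    pa<c : depth pa < suc c
    pa<c = ≤-reflexive (cong suc dpa)
  ...   | no pa≢pb = record
    { inner = inner′ ; nonempty = s≤s z≤n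
    ; simple = simple-path inner′ (Bridge.simple below) shallow′ da db a≢b
    ; linked = a~pa ∷ linked-snoc (Bridge.inner below) (Bridge.linked below) (adj-sym b~pb)
    ; shallow = shallow′ }
    where
    below : Bridge c pa pb
    below = bridge c pa≢pb dpa dpb
    inner′ : List (Fin m)
    inner′ = pa ∷ Bridge.inner below ++ pb ∷ []
    shallow′ : All (λ v → depth v < suc c) inner′
    shallow′ = ≤-reflexive (cong suc dpa)
               ∷ Allₚ.++⁺ (All.map m<n⇒m<1+n (Bridge.shallow below)) (≤-reflexive (cong suc dpb) ∷ [])

  -- No edge joins two vertices of equal depth (the bridge's interior is
  -- nonempty, so bridge plus edge is a genuine cycle).
  no-level-edge : ∀ {u w} → Adj T u w → depth u ≢ depth w
  no-level-edge {u} {w} a e with bridge (depth u) (adj-irrefl a) refl (sym e)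
  ... | record { inner = y ∷ L ; simple = simple ; linked = linked } =
    acyclic (u , y ∷ L ++ w ∷ [] , two≤length y L w , simple , linked-snoc (y ∷ L) linked (adj-sym a))

  parent-unique : ∀ {w u₁ u₂ c} → Adj T w u₁ → Adj T w u₂ →
                  depth u₁ ≡ c → depth u₂ ≡ c → depth w ≡ suc c → u₁ ≡ u₂
  parent-unique {w} {u₁} {u₂} {c} a₁ a₂ d₁ d₂ dw with u₁ ≟ᶠ u₂
  ... | yes u₁≡u₂ = u₁≡u₂
  ... | no  u₁≢u₂ with bridge c u₁≢u₂ d₁ d₂
  ...   | record { inner = L ; simple = simple ; linked = linked ; shallow = shallow } =
    ⊥-elim (acyclic (w , u₁ ∷ L ++ u₂ ∷ [] , two≤length u₁ L u₂ ,
                     All.map (λ lt → shallower⇒≢ lt ∘ sym) cycle-below-w ∷ simple ,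
                     a₁ ∷ linked-snoc L linked (adj-sym a₂)))
    where
    below : ∀ {v} → depth v < suc c → depth v < depth w
    below lt = subst (_ <_) (sym dw) lt
    cycle-below-w : All (λ v → depth v < depth w) (u₁ ∷ L ++ u₂ ∷ [])
    cycle-below-w = below (≤-reflexive (cong suc d₁))
      ∷ Allₚ.++⁺ (All.map (below ∘ m<n⇒m<1+n) shallow) (below (≤-reflexive (cong suc d₂)) ∷ [])

  edge-depth : ∀ {u w} → Adj T u w → depth w ≡ suc (depth u) ⊎ depth u ≡ suc (depth w)
  edge-depth {u} {w} a with <-cmp (depth u) (depth w)
  ... | tri< lt _ _ = inj₁ (≤-antisym (dist-stepʳ s (inj₂ a)) lt)
  ... | tri≈ _ e _  = contradiction e (no-level-edge a)
  ... | tri> _ _ gt = inj₂ (≤-antisym (dist-stepʳ s (inj₂ (adj-sym a))) gt)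

  -- Fix a neighbour z of the root.  Its branch consists of the vertices
  -- whose geodesics from the root pass through z.
  module Branch {z : Fin m} (s~z : Adj T s z) where

    InBranch : Fin m → Set
    InBranch w = suc (d z w) ≡ depth w

    branch-closed : ∀ {u w} → InBranch u → Adj T u w → w ≢ s → InBranch w
    branch-closed {u} {w} inU u~w w≢s with edge-depth u~w
    ... | inj₁ up = ≤-antisym
      (≤-trans (s≤s (dist-stepʳ z (inj₂ u~w))) (≤-reflexive (trans (cong suc inU) (sym up))))
      (dist-stepˡ w (inj₂ s~z))
    ... | inj₂ down with depth w in dw
    ...   | zero  = contradiction (sym (dist-zero dw)) w≢s
    ...   | suc c with dist-pred (trans (dist-sym u z) (suc-injective (trans inU down)))
    ...     | y , u~y , dyz = cong suc (subst (λ v → d z v ≡ c) y≡w (trans (dist-sym z y) dyz))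
      where
      dy : depth y ≡ suc c
      dy = ≤-antisym (≤-trans (dist-stepˡ y (inj₂ s~z)) (s≤s (≤-reflexive (trans (dist-sym z y) dyz))))
                     (s≤s⁻¹ (≤-trans (≤-reflexive (sym down)) (dist-stepʳ s (inj₂ (adj-sym u~y)))))
      y≡w : y ≡ w
      y≡w = parent-unique u~y u~w dy dw down

    separation : ∀ k {u r} → d u r ≡ k → InBranch u → ¬ InBranch r → d u s + depth r ≤ d u r
    separation zero {u} {r} e inU ¬inR with dist-zero e
    ... | refl = contradiction inU ¬inR
    separation (suc k) {u} {r} e inU ¬inR with dist-pred e
    ... | v , u~v , dvr = begin
      d u s + depth r       ≤⟨ +-monoˡ-≤ (depth r) (dist-stepˡ s (inj₂ u~v)) ⟩
      suc (d v s + depth r) ≤⟨ s≤s through-v ⟩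
      suc (d v r)           ≡⟨ cong suc dvr ⟩
      suc k                 ≡⟨ sym e ⟩
      d u r                 ∎
      where
      open ≤-Reasoning
      through-v : d v s + depth r ≤ d v r
      through-v with v ≟ᶠ s
      ... | yes refl = ≤-reflexive (cong (_+ depth r) (dist-self s))
      ... | no  v≢s  = separation k dvr (branch-closed inU u~v v≢s) ¬inR

    geodesic-through : ∀ {r₁ r} → InBranch r₁ → depth r ≤ d z r → d z r₁ + d z r ≤ d r₁ r
    geodesic-through {r₁} {r} inR₁ r-near-root = begin
      d z r₁ + d z r         ≤⟨ +-monoʳ-≤ (d z r₁) (dist-stepˡ r (inj₂ (adj-sym s~z))) ⟩
      d z r₁ + suc (depth r) ≡⟨ +-suc (d z r₁) (depth r) ⟩
      suc (d z r₁) + depth r ≡⟨ cong (_+ depth r) (trans inR₁ (dist-sym s r₁)) ⟩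
      d r₁ s + depth r       ≤⟨ separation _ refl inR₁ ¬inR ⟩
      d r₁ r                 ∎
      where
      open ≤-Reasoning
      ¬inR : ¬ InBranch r
      ¬inR inR = <-irrefl refl (≤-trans (≤-reflexive inR) r-near-root)

module Shadow {n m : ℕ} (G : Graph n) (T : Graph m) (connG : Connected G) (connT : Connected T)
              (acyclic : ¬ HasCycle T) (f : Fin m → Fin n)
              (iso : ∀ x y → dist T x y ≡ dist G (f x) (f y)) where
  module Gw = Walks G
  module Tw = Walks T
  module Gd = Distance G connG
  module Td = Distance T connT

  dG : Fin n → Fin n → ℕ
  dG = Gd.d
  dT : Fin m → Fin m → ℕ
  dT = Td.d

  Shadows : Fin m → Fin n → Set
  Shadows s x = ∀ r → dT s r ≤ dG x (f r)

  -- a neighbour of s closer to r (s itself when s = r)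
  toward : Fin m → Fin m → Fin m
  toward s r with Finₚ.any? (λ z → (adj T s z ≟ᵇ true) ×-dec (suc (dT z r) ≟ dT s r))
  ... | yes (z , _) = z
  ... | no  _       = s

  toward-spec : ∀ {s r c} → dT s r ≡ suc c → Adj T s (toward s r) × dT (toward s r) r ≡ c
  toward-spec {s} {r} e with Finₚ.any? (λ z → (adj T s z ≟ᵇ true) ×-dec (suc (dT z r) ≟ dT s r))
  ... | yes (z , s~z , dz) = s~z , suc-injective (trans dz e)
  ... | no  none with Td.dist-pred e
  ...   | z , s~z , dz = contradiction (z , s~z , trans (cong suc dz) (sym e)) none

  lost⇒tight : ∀ {s x x' r₁} → Shadows s x → Step G x x' → dG x' (f r₁) < dT s r₁ →
               dT s r₁ ≡ suc (dG x' (f r₁))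
  lost⇒tight {r₁ = r₁} sh x→x' lost = ≤-antisym (≤-trans (sh r₁) (Gd.dist-stepˡ (f r₁) x→x')) lost

  -- For the tree
  -- vertices r not closer to z than to s, z lies on a geodesic from r₁ to r.
  shadow-step : ∀ {s x x' r₁} → Shadows s x → Step G x x' → dG x' (f r₁) < dT s r₁ →
                Shadows (toward s r₁) x'
  shadow-step {s} {x} {x'} {r₁} sh x→x' lost r with toward-spec (lost⇒tight sh x→x' lost)
  ... | s~z , dz with dT (toward s r₁) r <? dT s r
  ...   | yes closer = s≤s⁻¹ (≤-trans closer (≤-trans (sh r) (Gd.dist-stepˡ (f r) x→x')))
  ...   | no  farther = +-cancelˡ-≤ (dG x' (f r₁)) _ _ (begin
      dG x' (f r₁) + dT z r      ≡⟨ cong (_+ dT z r) (sym dz) ⟩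
      dT z r₁ + dT z r           ≤⟨ geodesic-through r₁-behind-z (≮⇒≥ farther) ⟩
      dT r₁ r                    ≡⟨ iso r₁ r ⟩
      dG (f r₁) (f r)            ≤⟨ Gd.dist-tri (f r₁) x' (f r) ⟩
      dG (f r₁) x' + dG x' (f r) ≡⟨ cong (_+ dG x' (f r)) (Gd.dist-sym (f r₁) x') ⟩
      dG x' (f r₁) + dG x' (f r) ∎)
    where
    open ≤-Reasoning
    z : Fin m
    z = toward s r₁
    open Rooted.Branch T connT acyclic s s~z using (geodesic-through)
    r₁-behind-z : suc (dT z r₁) ≡ dT s r₁
    r₁-behind-z = trans (cong suc dz) (sym (lost⇒tight sh x→x' lost))

  chase : Fin m → Fin n → Fin m
  chase s x with Finₚ.any? (λ r → dG x (f r) <? dT s r)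
  ... | yes (r , _) = toward s r
  ... | no  _       = s

  chase-spec : ∀ {s x x'} → Shadows s x → Step G x x' → Step T s (chase s x') × Shadows (chase s x') x'
  chase-spec {s} {x} {x'} sh x→x' with Finₚ.any? (λ r → dG x' (f r) <? dT s r)
  ... | no  none        = inj₁ refl , λ r → ≮⇒≥ (λ lt → none (r , lt))
  ... | yes (r₁ , lost) =
    inj₂ (proj₁ (toward-spec (lost⇒tight sh x→x' lost))) , shadow-step sh x→x' lost

  -- Every graph vertex has a shadow: chase along a geodesic from f r₀.
  shadow-along : ∀ r₀ k {x} → dG x (f r₀) ≡ k → ∃ λ s → Shadows s x
  shadow-along r₀ zero    e with Gd.dist-zero e
  ... | refl = r₀ , λ r → ≤-reflexive (iso r₀ r)
  shadow-along r₀ (suc k) e with Gd.dist-pred e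
  ... | y , x~y , dy with shadow-along r₀ k dy
  ...   | s , sh = chase s _ , proj₂ (chase-spec sh (inj₂ (Gw.adj-sym x~y)))

  shadow-of : Fin m → Fin n → Fin m
  shadow-of r₀ x = proj₁ (shadow-along r₀ _ {x} refl)

  shadow-of-spec : ∀ r₀ x → Shadows (shadow-of r₀ x) x
  shadow-of-spec r₀ x = proj₂ (shadow-along r₀ _ {x} refl)

  shadow-sees : ∀ {s x r} ℓ → Shadows s x → within G ℓ x (f r) ≡ true → within T ℓ s r ≡ true
  shadow-sees {s} {x} {r} ℓ sh e =
    Tw.holds (Td.dist≤⇒reach (≤-trans (sh r) (Gd.dist-least (Gw.reach {k = ℓ} e))))

  shadows-see : ∀ {k} ℓ {S : Config m k} {C : Config n k} {r} → (∀ i → Shadows (S i) (C i)) →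
                visible G ℓ C (f r) ≡ true → visible T ℓ S r ≡ true
  shadows-see {k} ℓ {S} {C} {r} sh seen with any-witness (λ i → within G ℓ (C i) (f r)) (allFin k) seen
  ... | i , i-sees = any-intro (λ i → within T ℓ (S i) r) (∈-allFin i) (shadow-sees ℓ (sh i) i-sees)

  shadow-catches : ∀ {s x r} → Shadows s x → x ≡ f r → s ≡ r
  shadow-catches {s} {r = r} sh refl =
    Td.dist-zero (n≤0⇒n≡0 (≤-trans (sh r) (≤-reflexive (Gd.dist-self (f r)))))

-- Reading an observation history as a sequence of pairs (the two
-- observations made in each round after the first).
flatten : ∀ {X : Set} → List (X × X) → List X
flatten []            = []
flatten ((a , b) ∷ P) = a ∷ b ∷ flatten P

flatten-snoc : ∀ {X : Set} (P : List (X × X)) a b → flatten (P ++ (a , b) ∷ []) ≡ flatten P ++ a ∷ b ∷ []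
flatten-snoc []            a b = refl
flatten-snoc ((x , y) ∷ P) a b = cong (λ l → x ∷ y ∷ l) (flatten-snoc P a b)

-- Given a strategy σ for k cops on G, the cops on T
-- shadow the G-cops.  Reading their own observations, the T-cops replay σ:
-- they reconstruct what the G-cops would have observed against the image
-- of the robber under f, hence σ's moves, and each chases the shadow of its
-- G-counterpart.

module Transfer {n m : ℕ} (G : Graph n) (T : Graph m) (connG : Connected G) (connT : Connected T)
                (acyclic : ¬ HasCycle T) (f : Fin m → Fin n)
                (edges : ∀ x y → Adj T x y → Adj G (f x) (f y))
                (iso : ∀ x y → dist T x y ≡ dist G (f x) (f y))
                (ℓ : ℕ) {k : ℕ} (σ : Strategy n k) (r₀ : Fin m) where
  open Shadow G T connG connT acyclic f iso

  -- what G-cops at C observe when their shadows observe o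
  translate : Config n k → Maybe (Fin m) → Maybe (Fin n)
  translate C nothing  = nothing
  translate C (just r) = observe G ℓ C (f r)

  translate-observe : ∀ (S : Config m k) (C : Config n k) → (∀ i → Shadows (S i) (C i)) →
                      ∀ r → translate C (observe T ℓ S r) ≡ observe G ℓ C (f r)
  translate-observe S C sh r with visible T ℓ S r in seenT
  ... | true  = refl
  ... | false with visible G ℓ C (f r) in seenG
  ...   | false = refl
  ...   | true  = contradiction (trans (sym (shadows-see ℓ sh seenG)) seenT) true≢false

  -- the T-cops' memory: the reconstructed G-history and their own positions
  record Sim : Set where
    constructor sim
    field
      history : List (Maybe (Fin n))
      shadows : Config m k
  open Sim

  start-shadows : Config m k
  start-shadows i = shadow-of r₀ (start σ i)

  next-shadows : Sim → Config m k
  next-shadows st i = chase (shadows st i) (move σ (history st) i)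

  advance : Sim → Maybe (Fin m) → Maybe (Fin m) → Sim
  advance st a b = sim (history st ++ translate C a ∷ translate C b ∷ []) (next-shadows st)
    where
    C : Config n k
    C = move σ (history st)

  replay : Sim → List (Maybe (Fin m)) → Sim
  replay st []             = st
  replay st (a ∷ [])       = st
  replay st (a ∷ b ∷ rest) = replay (advance st a b) rest

  replay-snoc : ∀ st (P : List (Maybe (Fin m) × Maybe (Fin m))) a b →
                replay st (flatten P ++ a ∷ b ∷ []) ≡ advance (replay st (flatten P)) a b
  replay-snoc st []            a b = refl
  replay-snoc st ((x , y) ∷ P) a b = replay-snoc (advance st x y) P a b

  start-sim : Maybe (Fin m) → Sim
  start-sim o = sim (translate (start σ) o ∷ []) start-shadows

  reconstruct : List (Maybe (Fin m)) → Sim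
  reconstruct []       = start-sim nothing
  reconstruct (o ∷ os) = replay (start-sim o) os

  σT : Strategy m k
  σT = record { start = start-shadows ; move = λ h → next-shadows (reconstruct h) }

  module Play (wins : Wins G ℓ σ) (R : ℕ → Fin m) (walk : RobberWalk T R) where
    Rᴳ : ℕ → Fin n
    Rᴳ t = f (R t)

    walkᴳ : RobberWalk G Rᴳ
    walkᴳ t with walk t
    ... | inj₁ stay = inj₁ (cong f stay)
    ... | inj₂ a    = inj₂ (edges _ _ a)

    hG : ℕ → List (Maybe (Fin n))
    hG t = proj₂ (play G ℓ σ Rᴳ t)
    Cᴳ : ℕ → Config n k
    Cᴳ = cops G ℓ σ Rᴳ
    hT : ℕ → List (Maybe (Fin m))
    hT t = proj₂ (play T ℓ σT R t)
    Cᵀ : ℕ → Config m k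
    Cᵀ = cops T ℓ σT R

    o₀ : Maybe (Fin m)
    o₀ = observe T ℓ start-shadows (R 0)

    record Faithful (t : ℕ) : Set where
      field
        paired    : ∃ λ P → hT t ≡ o₀ ∷ flatten P
        history≡  : history (reconstruct (hT t)) ≡ hG t
        shadows≡  : ∀ i → shadows (reconstruct (hT t)) i ≡ Cᵀ t i
        shadowing : ∀ i → Shadows (Cᵀ t i) (Cᴳ t i)
    open Faithful

    faithful-start : Faithful 0
    faithful-start = record
      { paired    = [] , refl
      ; history≡  = cong (_∷ []) (translate-observe start-shadows (start σ) start-spec (R 0))
      ; shadows≡  = λ i → refl
      ; shadowing = start-spec }
      where
      start-spec : ∀ i → Shadows (start-shadows i) (start σ i)
      start-spec i = shadow-of-spec r₀ (start σ i)

    cop-step : ∀ t → Faithful t → (∀ i → Step G (Cᴳ t i) (Cᴳ (suc t) i)) →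
               ∀ i → Step T (Cᵀ t i) (Cᵀ (suc t) i) × Shadows (Cᵀ (suc t) i) (Cᴳ (suc t) i)
    cop-step t F legal i =
      subst (λ c → Step T (Cᵀ t i) c × Shadows c (Cᴳ (suc t) i)) (sym chased)
            (chase-spec (shadowing F i) (legal i))
      where
      chased : Cᵀ (suc t) i ≡ chase (Cᵀ t i) (Cᴳ (suc t) i)
      chased = cong₂ (λ s h → chase s (move σ h i)) (shadows≡ F i) (history≡ F)

    faithful-step : ∀ t → (∀ i → Step G (Cᴳ t i) (Cᴳ (suc t) i)) → Faithful t → Faithful (suc t)
    faithful-step t legal F = record
      { paired    = P ++ (a , b) ∷ [] , trans (cong (_++ a ∷ b ∷ []) hT≡) (cong (o₀ ∷_) (sym (flatten-snoc P a b)))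
      ; history≡  = trans (cong history replayed) translated
      ; shadows≡  = λ i → cong (λ st → shadows st i) replayed
      ; shadowing = shadowing′ }
      where
      P : List (Maybe (Fin m) × Maybe (Fin m))
      P = proj₁ (paired F)
      hT≡ : hT t ≡ o₀ ∷ flatten P
      hT≡ = proj₂ (paired F)
      a b : Maybe (Fin m)
      a = observe T ℓ (Cᵀ (suc t)) (R t)
      b = observe T ℓ (Cᵀ (suc t)) (R (suc t))
      replayed : reconstruct (hT (suc t)) ≡ advance (reconstruct (hT t)) a b
      replayed = begin
        reconstruct (hT t ++ a ∷ b ∷ [])               ≡⟨ cong (λ h → reconstruct (h ++ a ∷ b ∷ [])) hT≡ ⟩
        replay (start-sim o₀) (flatten P ++ a ∷ b ∷ []) ≡⟨ replay-snoc (start-sim o₀) P a b ⟩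
        advance (replay (start-sim o₀) (flatten P)) a b ≡⟨ cong (λ h → advance (reconstruct h) a b) (sym hT≡) ⟩
        advance (reconstruct (hT t)) a b               ∎
        where open ≡-Reasoning
      shadowing′ : ∀ i → Shadows (Cᵀ (suc t) i) (Cᴳ (suc t) i)
      shadowing′ i = proj₂ (cop-step t F legal i)
      translated : history (advance (reconstruct (hT t)) a b) ≡ hG (suc t)
      translated = trans
        (cong (λ h → h ++ translate (move σ h) a ∷ translate (move σ h) b ∷ []) (history≡ F))
        (cong₂ (λ u v → hG t ++ u ∷ v ∷ [])
               (translate-observe (Cᵀ (suc t)) (Cᴳ (suc t)) shadowing′ (R t))
               (translate-observe (Cᵀ (suc t)) (Cᴳ (suc t)) shadowing′ (R (suc t))))

    legal : ∀ t (i : Fin k) → Step G (Cᴳ t i) (Cᴳ (suc t) i)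
    legal = proj₁ (wins Rᴳ walkᴳ)

    faithful : ∀ t → Faithful t
    faithful zero    = faithful-start
    faithful (suc t) = faithful-step t (legal t) (faithful t)

    cops-legal : ∀ t (i : Fin k) → Step T (Cᵀ t i) (Cᵀ (suc t) i)
    cops-legal t i = proj₁ (cop-step t (faithful t) (legal t) i)

    caught : ∃ λ t → ∃ λ (i : Fin k) → (Cᵀ t i ≡ R t) ⊎ (Cᵀ (suc t) i ≡ R t)
    caught with proj₂ (wins Rᴳ walkᴳ)
    ... | t , i , inj₁ e = t , i , inj₁ (shadow-catches (shadowing (faithful t) i) e)
    ... | t , i , inj₂ e = t , i , inj₂ (shadow-catches (shadowing (faithful (suc t)) i) e)

  wins-transfer : Wins G ℓ σ → Wins T ℓ σT
  wins-transfer wins R walk = Play.cops-legal wins R walk , Play.caught wins R walk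

copwin-transfer : ∀ {n m} (G : Graph n) (T : Graph m) (ℓ k : ℕ) → Connected G → IsTree T →
                  (f : Fin m → Fin n) → IsIsometricSubgraph T G f → Fin m →
                  CopWin G ℓ k → CopWin T ℓ k
copwin-transfer G T ℓ k connG (connT , acyclic) f ((_ , edges) , iso) r₀ (σ , wins) =
  Transfer.σT G T connG connT acyclic f edges iso ℓ σ r₀ ,
  Transfer.wins-transfer G T connG connT acyclic f edges iso ℓ σ r₀ wins

empty-copwin : ∀ (T : Graph 0) ℓ → CopWin T ℓ 0
empty-copwin T ℓ = record { start = λ () ; move = λ _ () } , λ R _ → ⊥-elim (Finₚ.¬Fin0 (R 0))

corollary2p2 : ∀ {n m} (G : Graph n) (T : Graph m) (ℓ : ℕ) → 1 ≤ ℓ →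
    Connected G → IsTree T → (f : Fin m → Fin n) → IsIsometricSubgraph T G f →
    ∀ cT cG → IsCopNumber T ℓ cT → IsCopNumber G ℓ cG → cT ≤ cG
corollary2p2 {m = zero}  G T ℓ _ connG treeT f isometric cT cG (_ , leastT) _ =
  ≤-trans (leastT 0 (empty-copwin T ℓ)) z≤n
corollary2p2 {m = suc _} G T ℓ _ connG treeT f isometric cT cG (_ , leastT) (winG , _) =
  leastT cG (copwin-transfer G T ℓ cG connG treeT f isometric fzero winG)
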